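{- Let $T:[n_1]\times[n_2]\times[n_3]\to\mathbb{F}$ be an order-$3$ tensor. Assume that for every $\theta\in[4]$ there are nonnegative integers $r_\theta,s_\theta,t_\theta$ and functions $a_i^\theta:[n_1]\to\mathbb{F}$, $c_j^\theta:[n_2]\to\mathbb{F}$, $e_k^\theta:[n_3]\to\mathbb{F}$, $b_i^\theta:[n_2]\times[n_3]\to\mathbb{F}$, $d_j^\theta:[n_1]\times[n_3]\to\mathbb{F}$, $f_k^\theta:[n_1]\times[n_2]\to\mathbb{F}$ such that \[T(x,y,z)=\sum_{i=1}^{r_\theta}a_i^\theta(x)b_i^\theta(y,z)+\sum_{j=1}^{s_\theta}c_j^\theta(y)d_j^\theta(x,z)+\sum_{k=1}^{t_\theta}e_k^\theta(z)f_k^\theta(x,y).\] Assume that the families $(a_i^\theta:\theta\in[4],i\in[r_\theta])$, $(c_j^\theta:\theta\in[4],j\in[s_\theta])$, $(e_k^\theta:\theta\in[4],k\in[t_\theta])$ are each linearly independent. Then $T=0$.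
   Context: $\mathbb{F}$ is a field, $[n]=\{1,\dots,n\}$. -}

module Defs where

open import Level using (Level; _⊔_)
open import Data.Nat using (ℕ; zero; suc)
open import Data.Fin using (Fin; zero; suc)
open import Data.Product using (Σ; _,_; ∃-syntax)
open import Relation.Nullary using (¬_)
open import Algebra.Bundles using (CommutativeRing)

record Field (c ℓ : Level) : Set (Level.suc (c ⊔ ℓ)) where
  field
    commutativeRing : CommutativeRing c ℓ
  open CommutativeRing commutativeRing public
  field
    0≉1     : ¬ (0# ≈ 1#)
    inverse : ∀ x → ¬ (x ≈ 0#) → ∃[ y ] (x * y ≈ 1#)

module FieldOps {c ℓ : Level} (F : Field c ℓ) where
  open Field F using (Carrier; _≈_; _+_; _*_; 0#)

  ∑ : (n : ℕ) → (Fin n → Carrier) → Carrier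
  ∑ zero    f = 0#
  ∑ (suc n) f = f zero + ∑ n (λ i → f (suc i))

  ∑Σ : (m : ℕ) (r : Fin m → ℕ) → (Σ (Fin m) (λ θ → Fin (r θ)) → Carrier) → Carrier
  ∑Σ m r f = ∑ m (λ θ → ∑ (r θ) (λ i → f (θ , i)))

  LinearlyIndependent : (m : ℕ) (r : Fin m → ℕ) (N : ℕ)
    → (Σ (Fin m) (λ θ → Fin (r θ)) → Fin N → Carrier) → Set (c ⊔ ℓ)
  LinearlyIndependent m r N v =
    (λc : Σ (Fin m) (λ θ → Fin (r θ)) → Carrier)
    → (∀ x → ∑Σ m r (λ ι → λc ι * v ι x) ≈ 0#)
    → ∀ ι → λc ι ≈ 0#

flatten : {a : Level} {A : Set a} {m : ℕ} {r : Fin m → ℕ}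
  → ((θ : Fin m) → Fin (r θ) → A) → Σ (Fin m) (λ θ → Fin (r θ)) → A
flatten g (θ , i) = g θ i

-- Each of the three independent families admits dual functionals, so in every slot the
-- evaluation at a point (up to a scalar) splits into five linear components: one
-- projection per decomposition θ, which annihilates the vectors of every other
-- decomposition, and a remainder annihilating all of them. Applying one component in
-- each slot to T, at most three of the four decompositions are hit by the chosen
-- projections, and expanding T along a remaining one shows that every term vanishes.
-- Summing over all 5³ choices recovers the scaled value of T at the point, hence T = 0.
-- Nothing beyond the commutative ring structure is used.
module Submission where

open import Defs
open import Level using (Level; 0ℓ; _⊔_) renaming (suc to lsuc)
open import Algebra.Bundles using (CommutativeRing)
open import Data.Nat using (ℕ; zero; suc) renaming (_+_ to _+ℕ_)
open import Data.Fin using (Fin; zero; suc; _↑ˡ_; _↑ʳ_; splitAt)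
open import Data.Fin.Properties
  using (suc-injective; _≟_; all?; any?; splitAt-↑ˡ; splitAt-↑ʳ; splitAt⁻¹-↑ˡ; splitAt⁻¹-↑ʳ)
open import Data.Product using (Σ; ∃-syntax; _×_; _,_; proj₁)
import Data.Product as Product
open import Data.Sum using (inj₁; inj₂; [_,_]′)
open import Data.Unit using (⊤; tt)
open import Data.Empty using (⊥-elim)
open import Function using (_∘_; id)
open import Relation.Nullary using (¬?)
open import Relation.Nullary.Decidable using (toWitness; _×-dec_)
open import Relation.Binary.PropositionalEquality as ≡ using (_≡_; _≢_)

FinΣ : ∀ {k} → (Fin k → ℕ) → Set
FinΣ {k} r = Σ (Fin k) (λ θ → Fin (r θ))

total : ∀ {k} → (Fin k → ℕ) → ℕ
total {zero}  r = 0
total {suc k} r = r zero +ℕ total (r ∘ suc)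

encode : ∀ {k} (r : Fin k → ℕ) → FinΣ r → Fin (total r)
encode {suc k} r (zero  , i) = i ↑ˡ total (r ∘ suc)
encode {suc k} r (suc θ , i) = r zero ↑ʳ encode (r ∘ suc) (θ , i)

decode : ∀ {k} (r : Fin k → ℕ) → Fin (total r) → FinΣ r
decode {suc k} r j =
  [ (λ i → zero , i) , (λ j′ → Product.map suc id (decode (r ∘ suc) j′)) ]′ (splitAt (r zero) j)

decode-encode : ∀ {k} (r : Fin k → ℕ) ι → decode r (encode r ι) ≡ ι
decode-encode {suc k} r (zero , i) rewrite splitAt-↑ˡ (r zero) i (total (r ∘ suc)) = ≡.refl
decode-encode {suc k} r (suc θ , i)
  rewrite splitAt-↑ʳ (r zero) (total (r ∘ suc)) (encode (r ∘ suc) (θ , i))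
        | decode-encode (r ∘ suc) (θ , i) = ≡.refl

encode-decode : ∀ {k} (r : Fin k → ℕ) j → encode r (decode r j) ≡ j
encode-decode {suc k} r j with splitAt (r zero) j in eq
... | inj₁ i  = splitAt⁻¹-↑ˡ eq
... | inj₂ j′ = ≡.trans (≡.cong (r zero ↑ʳ_) (encode-decode (r ∘ suc) j′)) (splitAt⁻¹-↑ʳ eq)

module TensorVanishing {c ℓ : Level} (R : CommutativeRing c ℓ) where
  open CommutativeRing R hiding (zero)
  open import Algebra.Properties.Ring ring
    using (-‿distribˡ-*; -‿+-comm; -0#≈0#; x[y-z]≈xy-xz; x≈y⇒x∙y⁻¹≈ε; //-rightDividesˡ)
  open import Algebra.Properties.CommutativeSemigroup +-commutativeSemigroup
    using (interchange)
  open import Algebra.Properties.CommutativeSemigroup *-commutativeSemigroup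
    using (x∙yz≈y∙xz; x∙yz≈yx∙z; xy∙z≈xz∙y)
  open import Algebra.Properties.Semiring.Sum semiring
    using (sum; sum-cong-≋; sum-replicate-zero; ∑-distrib-+; *-distribˡ-sum; *-distribʳ-sum)
  open import Relation.Binary.Reasoning.Setoid setoid

  sum-zero : ∀ {n} {f : Fin n → Carrier} → (∀ i → f i ≈ 0#) → sum f ≈ 0#
  sum-zero {n} f≈0 = trans (sum-cong-≋ f≈0) (sum-replicate-zero n)

  -‿sum : ∀ {n} (f : Fin n → Carrier) → - sum f ≈ sum (λ i → - f i)
  -‿sum {zero}  f = -0#≈0#
  -‿sum {suc n} f = trans (sym (-‿+-comm (f zero) _)) (+-congˡ (-‿sum (f ∘ suc)))

  sum-δ : ∀ {n} {f : Fin n → Carrier} κ → (∀ i → i ≢ κ → f i ≈ 0#) → sum f ≈ f κ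
  sum-δ {suc n} zero    f≈0 = trans (+-congˡ (sum-zero (λ i → f≈0 (suc i) λ ()))) (+-identityʳ _)
  sum-δ {suc n} (suc κ) f≈0 = trans (+-congʳ (f≈0 zero λ ())) (trans (+-identityˡ _)
    (sum-δ κ (λ i i≢κ → f≈0 (suc i) (i≢κ ∘ suc-injective))))

  sum-↑ : ∀ m {n} (f : Fin (m +ℕ n) → Carrier) →
          sum f ≈ sum (λ i → f (i ↑ˡ n)) + sum (λ j → f (m ↑ʳ j))
  sum-↑ zero    f = sym (+-identityˡ _)
  sum-↑ (suc m) f = trans (+-congˡ (sum-↑ m (f ∘ suc))) (sym (+-assoc _ _ _))

  sumΣ : ∀ {k} (r : Fin k → ℕ) → (FinΣ r → Carrier) → Carrier
  sumΣ r f = sum (λ θ → sum (λ i → f (θ , i)))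

  sumΣ-δ : ∀ {k} {r : Fin k → ℕ} {f : FinΣ r → Carrier} κ →
           (∀ ι → ι ≢ κ → f ι ≈ 0#) → sumΣ r f ≈ f κ
  sumΣ-δ (θ , i) f≈0 = trans
    (sum-δ θ (λ θ′ θ′≢θ → sum-zero (λ i′ → f≈0 (θ′ , i′) (θ′≢θ ∘ ≡.cong proj₁))))
    (sum-δ i (λ i′ i′≢i → f≈0 (θ , i′) λ { ≡.refl → i′≢i ≡.refl }))

  sum-encode : ∀ {k} (r : Fin k → ℕ) (f : Fin (total r) → Carrier) →
               sum f ≈ sumΣ r (f ∘ encode r)
  sum-encode {zero}  r f = refl
  sum-encode {suc k} r f =
    trans (sum-↑ (r zero) f) (+-congˡ (sum-encode (r ∘ suc) (λ j → f (r zero ↑ʳ j))))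

  Independent : {I A : Set} → ((I → Carrier) → Carrier) → (I → A → Carrier) → Set (c ⊔ ℓ)
  Independent {I} ∑I v =
    (λc : I → Carrier) → (∀ a → ∑I (λ ι → λc ι * v ι a) ≈ 0#) → ∀ ι → λc ι ≈ 0#

  independent-tail : ∀ {A m} {v : Fin (suc m) → A → Carrier} →
                     Independent sum v → Independent sum (v ∘ suc)
  independent-tail ind λc λc·v≈0 κ =
    ind (λ { zero → 0# ; (suc i) → λc i })
        (λ a → trans (trans (+-congʳ (zeroˡ _)) (+-identityˡ _)) (λc·v≈0 a))
        (suc κ)

  independent-decode : ∀ {A k} {r : Fin k → ℕ} {v : FinΣ r → A → Carrier} →
                       Independent (sumΣ r) v → Independent sum (v ∘ decode r)
  independent-decode {r = r} {v} ind λc λc·v≈0 j = trans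
    (reflexive (≡.cong λc (≡.sym (encode-decode r j))))
    (ind (λc ∘ encode r) (λ a → begin
      sumΣ r (λ ι → λc (encode r ι) * v ι a)
        ≈⟨ sum-cong-≋ (λ θ → sum-cong-≋ (λ i → *-congˡ (reflexive
             (≡.cong (λ ι → v ι a) (≡.sym (decode-encode r (θ , i))))))) ⟩
      sumΣ r (λ ι → λc (encode r ι) * v (decode r (encode r ι)) a)
        ≈⟨ sym (sum-encode r (λ j′ → λc j′ * v (decode r j′) a)) ⟩
      sum (λ j′ → λc j′ * v (decode r j′) a)
        ≈⟨ λc·v≈0 a ⟩
      0# ∎) (decode r j))

  record Functional (A : Set) : Set (c ⊔ ℓ) where
    field
      apply      : (A → Carrier) → Carrier
      apply-cong : ∀ {g h} → (∀ a → g a ≈ h a) → apply g ≈ apply h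
      apply-+    : ∀ g h → apply (λ a → g a + h a) ≈ apply g + apply h
      apply-*    : ∀ k g → apply (λ a → k * g a) ≈ k * apply g

  open Functional

  infix 9 _⟪_⟫
  _⟪_⟫ : ∀ {A} → Functional A → (A → Carrier) → Carrier
  _⟪_⟫ = apply

  evalAt : ∀ {A} → A → Functional A
  evalAt a = record
    { apply      = λ g → g a
    ; apply-cong = λ g≈h → g≈h a
    ; apply-+    = λ _ _ → refl
    ; apply-*    = λ _ _ → refl
    }

  infixr 8 _·ᶠ_
  _·ᶠ_ : ∀ {A} → Carrier → Functional A → Functional A
  k ·ᶠ L = record
    { apply      = λ g → k * L ⟪ g ⟫
    ; apply-cong = λ g≈h → *-congˡ (apply-cong L g≈h)
    ; apply-+    = λ g h → trans (*-congˡ (apply-+ L g h)) (distribˡ k _ _)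
    ; apply-*    = λ k′ g → trans (*-congˡ (apply-* L k′ g)) (x∙yz≈y∙xz k k′ _)
    }

  infixl 7 _−ᶠ_
  _−ᶠ_ : ∀ {A} → Functional A → Functional A → Functional A
  L −ᶠ M = record
    { apply      = λ g → L ⟪ g ⟫ - M ⟪ g ⟫
    ; apply-cong = λ g≈h → +-cong (apply-cong L g≈h) (-‿cong (apply-cong M g≈h))
    ; apply-+    = λ g h → trans
        (+-cong (apply-+ L g h) (trans (-‿cong (apply-+ M g h)) (sym (-‿+-comm _ _))))
        (interchange _ _ _ _)
    ; apply-*    = λ k g → trans (+-cong (apply-* L k g) (-‿cong (apply-* M k g)))
                                 (sym (x[y-z]≈xy-xz k _ _))
    }

  ∑ᶠ : ∀ {A n} → (Fin n → Functional A) → Functional A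
  ∑ᶠ L = record
    { apply      = λ g → sum (λ i → L i ⟪ g ⟫)
    ; apply-cong = λ g≈h → sum-cong-≋ (λ i → apply-cong (L i) g≈h)
    ; apply-+    = λ g h → trans (sum-cong-≋ (λ i → apply-+ (L i) g h))
                                 (∑-distrib-+ (λ i → L i ⟪ g ⟫) (λ i → L i ⟪ h ⟫))
    ; apply-*    = λ k g → trans (sum-cong-≋ (λ i → apply-* (L i) k g))
                                 (sym (*-distribˡ-sum k (λ i → L i ⟪ g ⟫)))
    }

  module _ {A : Set} (L : Functional A) where

    ⟪⟫-zero : ∀ {g} → (∀ a → g a ≈ 0#) → L ⟪ g ⟫ ≈ 0#
    ⟪⟫-zero g≈0 = begin
      L ⟪ _ ⟫                ≈⟨ apply-cong L (λ a → trans (g≈0 a) (sym (zeroˡ 0#))) ⟩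
      L ⟪ (λ _ → 0# * 0#) ⟫ ≈⟨ apply-* L 0# (λ _ → 0#) ⟩
      0# * L ⟪ (λ _ → 0#) ⟫ ≈⟨ zeroˡ _ ⟩
      0#                     ∎

    ⟪⟫-sum : ∀ {n} (h : Fin n → A → Carrier) →
             L ⟪ (λ a → sum (λ i → h i a)) ⟫ ≈ sum (λ i → L ⟪ h i ⟫)
    ⟪⟫-sum {zero}  h = ⟪⟫-zero (λ _ → refl)
    ⟪⟫-sum {suc n} h = trans (apply-+ L (h zero) _) (+-congˡ (⟪⟫-sum (h ∘ suc)))

    ⟪⟫-combination : ∀ {n} (k : Fin n → Carrier) (h : Fin n → A → Carrier) →
                     L ⟪ (λ a → sum (λ i → k i * h i a)) ⟫ ≈ sum (λ i → k i * L ⟪ h i ⟫)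
    ⟪⟫-combination k h =
      trans (⟪⟫-sum (λ i a → k i * h i a)) (sum-cong-≋ (λ i → apply-* L (k i) (h i)))

    ⟪⟫-annihilates-span : ∀ {n} (v : Fin n → A → Carrier) (k : Fin n → Carrier) →
                          (∀ i → L ⟪ v i ⟫ ≈ 0#) → L ⟪ (λ a → sum (λ i → v i a * k i)) ⟫ ≈ 0#
    ⟪⟫-annihilates-span v k Lv≈0 = begin
      L ⟪ (λ a → sum (λ i → v i a * k i)) ⟫
        ≈⟨ apply-cong L (λ a → sum-cong-≋ (λ i → *-comm (v i a) (k i))) ⟩
      L ⟪ (λ a → sum (λ i → k i * v i a)) ⟫
        ≈⟨ ⟪⟫-combination k v ⟩
      sum (λ i → k i * L ⟪ v i ⟫)
        ≈⟨ sum-zero (λ i → trans (*-congˡ (Lv≈0 i)) (zeroʳ _)) ⟩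
      0# ∎

  -- Over a field one would normalise to a dual basis, but without decidable equality no
  -- invertible scale can be singled out. Instead a whole family of scales is kept, whose
  -- common annihilator is zero; this needs no division at all.
  record DualFamily {I A : Set} (v : I → A → Carrier) : Set (lsuc 0ℓ ⊔ c ⊔ ℓ) where
    field
      Param          : Set
      scale          : Param → Carrier
      dual           : Param → I → Functional A
      dual-diag      : ∀ p ι → dual p ι ⟪ v ι ⟫ ≈ scale p
      dual-offdiag   : ∀ p {ι κ} → ι ≢ κ → dual p ι ⟪ v κ ⟫ ≈ 0#
      scale-faithful : ∀ a → (∀ p → scale p * a ≈ 0#) → a ≈ 0#

    dual-reproduces : (∑I : (I → Carrier) → Carrier) →
                      (∀ {f} κ → (∀ ι → ι ≢ κ → f ι ≈ 0#) → ∑I f ≈ f κ) →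
                      ∀ p a κ → ∑I (λ ι → v ι a * dual p ι ⟪ v κ ⟫) ≈ scale p * v κ a
    dual-reproduces ∑I ∑I-δ p a κ = begin
      ∑I (λ ι → v ι a * dual p ι ⟪ v κ ⟫)
        ≈⟨ ∑I-δ κ (λ ι ι≢κ → trans (*-congˡ (dual-offdiag p ι≢κ)) (zeroʳ _)) ⟩
      v κ a * dual p κ ⟪ v κ ⟫ ≈⟨ *-congˡ (dual-diag p κ) ⟩
      v κ a * scale p          ≈⟨ *-comm _ _ ⟩
      scale p * v κ a          ∎

  reindex : ∀ {I J A : Set} {v : I → A → Carrier} (f : J → I) (g : I → J) →
            (∀ ι → f (g ι) ≡ ι) → DualFamily (v ∘ f) → DualFamily v
  reindex {v = v} f g f∘g≗id D = record
    { Param          = D.Param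
    ; scale          = D.scale
    ; dual           = λ p ι → D.dual p (g ι)
    ; dual-diag      = λ p ι →
        ≡.subst (λ ι′ → D.dual p (g ι) ⟪ v ι′ ⟫ ≈ D.scale p) (f∘g≗id ι) (D.dual-diag p (g ι))
    ; dual-offdiag   = λ p {ι} {κ} ι≢κ →
        ≡.subst (λ κ′ → D.dual p (g ι) ⟪ v κ′ ⟫ ≈ 0#) (f∘g≗id κ)
          (D.dual-offdiag p λ gι≡gκ →
            ι≢κ (≡.trans (≡.sym (f∘g≗id ι)) (≡.trans (≡.cong f gι≡gκ) (f∘g≗id κ))))
    ; scale-faithful = D.scale-faithful
    }
    where module D = DualFamily D

  -- The residuals annihilate v₁, …, vₘ; their values ρ p a on v₀ become the new scales,
  -- and each old dual is corrected by a residual so as to annihilate v₀ as well.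
  module Extension {A : Set} {m} {v : Fin (suc m) → A → Carrier}
                   (ind : Independent sum v) (D : DualFamily (v ∘ suc)) where
    open DualFamily D

    residual : Param → A → Functional A
    residual p a = (scale p ·ᶠ evalAt a) −ᶠ ∑ᶠ (λ κ → v (suc κ) a ·ᶠ dual p κ)

    residual-kills : ∀ p a κ → residual p a ⟪ v (suc κ) ⟫ ≈ 0#
    residual-kills p a κ = x≈y⇒x∙y⁻¹≈ε (sym (dual-reproduces sum sum-δ p a κ))

    ρ : Param → A → Carrier
    ρ p a = residual p a ⟪ v zero ⟫

    coefficient : Param → Fin (suc m) → Carrier
    coefficient p zero    = scale p
    coefficient p (suc κ) = - dual p κ ⟪ v zero ⟫

    ρ-expansion : ∀ p a → ρ p a ≈ sum (λ i → coefficient p i * v i a)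
    ρ-expansion p a = +-congˡ (trans (-‿sum (λ κ → v (suc κ) a * dual p κ ⟪ v zero ⟫))
      (sum-cong-≋ (λ κ → trans (-‿cong (*-comm (v (suc κ) a) (dual p κ ⟪ v zero ⟫)))
                                (-‿distribˡ-* (dual p κ ⟪ v zero ⟫) (v (suc κ) a)))))

    Param⁺ : Set
    Param⁺ = Param × Param × A

    scale⁺ : Param⁺ → Carrier
    scale⁺ (p , q , a) = scale q * ρ p a

    dual⁺ : Param⁺ → Fin (suc m) → Functional A
    dual⁺ (p , q , a) zero    = scale q ·ᶠ residual p a
    dual⁺ (p , q , a) (suc κ) = (ρ p a ·ᶠ dual q κ) −ᶠ (dual q κ ⟪ v zero ⟫ ·ᶠ residual p a)

    *-residual-kills : ∀ p a κ k → k * residual p a ⟪ v (suc κ) ⟫ ≈ 0#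
    *-residual-kills p a κ k = trans (*-congˡ (residual-kills p a κ)) (zeroʳ k)

    dual⁺-diag : ∀ P i → dual⁺ P i ⟪ v i ⟫ ≈ scale⁺ P
    dual⁺-diag (p , q , a) zero    = refl
    dual⁺-diag (p , q , a) (suc κ) = begin
      ρ p a * dual q κ ⟪ v (suc κ) ⟫ - dual q κ ⟪ v zero ⟫ * residual p a ⟪ v (suc κ) ⟫
        ≈⟨ +-cong (*-congˡ (dual-diag q κ)) (-‿cong (*-residual-kills p a κ _)) ⟩
      ρ p a * scale q - 0# ≈⟨ trans (+-congˡ -0#≈0#) (+-identityʳ _) ⟩
      ρ p a * scale q      ≈⟨ *-comm _ _ ⟩
      scale q * ρ p a      ∎

    dual⁺-offdiag : ∀ P {i j} → i ≢ j → dual⁺ P i ⟪ v j ⟫ ≈ 0#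
    dual⁺-offdiag (p , q , a) {zero}  {zero}  0≢0 = ⊥-elim (0≢0 ≡.refl)
    dual⁺-offdiag (p , q , a) {zero}  {suc κ′} _ = *-residual-kills p a κ′ (scale q)
    dual⁺-offdiag (p , q , a) {suc κ} {zero}  _ = x≈y⇒x∙y⁻¹≈ε (*-comm _ _)
    dual⁺-offdiag (p , q , a) {suc κ} {suc κ′} sκ≢sκ′ = x≈y⇒x∙y⁻¹≈ε (trans
      (trans (*-congˡ (dual-offdiag q (sκ≢sκ′ ∘ ≡.cong suc))) (zeroʳ _))
      (sym (*-residual-kills p a κ′ _)))

    -- ρ p is a combination of v₀, …, vₘ with leading coefficient scale p, so independence
    -- turns the hypothesis into scale p · scale q · b ≈ 0, and the old scales are faithful.
    scale⁺-faithful : ∀ b → (∀ P → scale⁺ P * b ≈ 0#) → b ≈ 0#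
    scale⁺-faithful b scale⁺·b≈0 =
      scale-faithful b (λ q → scale-faithful (scale q * b) (λ p → leading p q))
      where
      leading : ∀ p q → scale p * (scale q * b) ≈ 0#
      leading p q = ind (λ i → coefficient p i * (scale q * b)) (λ a → begin
        sum (λ i → (coefficient p i * (scale q * b)) * v i a)
          ≈⟨ sum-cong-≋ (λ i → xy∙z≈xz∙y (coefficient p i) (scale q * b) (v i a)) ⟩
        sum (λ i → (coefficient p i * v i a) * (scale q * b))
          ≈⟨ sym (*-distribʳ-sum (scale q * b) (λ i → coefficient p i * v i a)) ⟩
        sum (λ i → coefficient p i * v i a) * (scale q * b)
          ≈⟨ *-congʳ (sym (ρ-expansion p a)) ⟩
        ρ p a * (scale q * b) ≈⟨ x∙yz≈yx∙z _ _ _ ⟩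
        scale⁺ (p , q , a) * b ≈⟨ scale⁺·b≈0 (p , q , a) ⟩
        0# ∎) zero

    extension : DualFamily v
    extension = record
      { Param          = Param⁺
      ; scale          = scale⁺
      ; dual           = dual⁺
      ; dual-diag      = dual⁺-diag
      ; dual-offdiag   = dual⁺-offdiag
      ; scale-faithful = scale⁺-faithful
      }

  dualFamily : ∀ {A m} {v : Fin m → A → Carrier} → Independent sum v → DualFamily v
  dualFamily {m = zero} _ = record
    { Param          = ⊤
    ; scale          = λ _ → 1#
    ; dual           = λ _ ()
    ; dual-diag      = λ _ ()
    ; dual-offdiag   = λ { _ {()} }
    ; scale-faithful = λ a 1·a≈0 → trans (sym (*-identityˡ a)) (1·a≈0 tt)
    }
  dualFamily {m = suc m} {v} ind =
    Extension.extension ind (dualFamily (independent-tail {v = v} ind))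

  dualFamilyΣ : ∀ {A k} {r : Fin k → ℕ} {v : FinΣ r → A → Carrier} →
                Independent (sumΣ r) v → DualFamily v
  dualFamilyΣ {r = r} ind =
    reindex (decode r) (encode r) (decode-encode r) (dualFamily (independent-decode ind))

  Resolves : ∀ {A n} → (Fin n → Functional A) → Carrier → A → Set (c ⊔ ℓ)
  Resolves L μ a = ∀ g → sum (λ α → L α ⟪ g ⟫) ≈ μ * g a

  module Resolution {A : Set} {k} {r : Fin k → ℕ} {v : FinΣ r → A → Carrier}
                    (D : DualFamily v) (p : DualFamily.Param D) (x : A) where
    open DualFamily D

    blockProjection : Fin k → Functional A
    blockProjection θ = ∑ᶠ (λ i → v (θ , i) x ·ᶠ dual p (θ , i))

    component : Fin (suc k) → Functional A
    component zero    = (scale p ·ᶠ evalAt x) −ᶠ ∑ᶠ blockProjection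
    component (suc θ) = blockProjection θ

    components-resolve : Resolves component (scale p) x
    components-resolve g = //-rightDividesˡ _ _

    component-kills : ∀ α θ i → α ≢ suc θ → component α ⟪ v (θ , i) ⟫ ≈ 0#
    component-kills zero     θ i _ =
      x≈y⇒x∙y⁻¹≈ε (sym (dual-reproduces (sumΣ r) sumΣ-δ p x (θ , i)))
    component-kills (suc θ′) θ i sθ′≢sθ = sum-zero (λ i′ → trans
      (*-congˡ (dual-offdiag p {θ′ , i′} (sθ′≢sθ ∘ ≡.cong (suc ∘ proj₁))))
      (zeroʳ (v (θ′ , i′) x)))

  apply₃ : ∀ {A B C} → Functional A → Functional B → Functional C →
           (A → B → C → Carrier) → Carrier
  apply₃ L M N U = L ⟪ (λ a → M ⟪ (λ b → N ⟪ U a b ⟫) ⟫) ⟫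

  apply₃-cong : ∀ {A B C} (L : Functional A) (M : Functional B) (N : Functional C) {U V} →
                (∀ a b c → U a b c ≈ V a b c) → apply₃ L M N U ≈ apply₃ L M N V
  apply₃-cong L M N U≈V =
    apply-cong L (λ a → apply-cong M (λ b → apply-cong N (U≈V a b)))

  apply₃-+ : ∀ {A B C} (L : Functional A) (M : Functional B) (N : Functional C) U V →
             apply₃ L M N (λ a b c → U a b c + V a b c) ≈ apply₃ L M N U + apply₃ L M N V
  apply₃-+ L M N U V = trans
    (apply-cong L (λ a →
      trans (apply-cong M (λ b → apply-+ N (U a b) (V a b))) (apply-+ M _ _)))
    (apply-+ L _ _)

  resolve₃ : ∀ {A B C l m n} {L : Fin l → Functional A} {M : Fin m → Functional B}
               {N : Fin n → Functional C} {λ₁ λ₂ λ₃ a b c} →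
             Resolves L λ₁ a → Resolves M λ₂ b → Resolves N λ₃ c → ∀ U →
             λ₁ * (λ₂ * (λ₃ * U a b c)) ≈
             sum (λ α → sum (λ β → sum (λ γ → apply₃ (L α) (M β) (N γ) U)))
  resolve₃ {L = L} {M} {N} {λ₁} {λ₂} {λ₃} {a} {b} {c} resL resM resN U = begin
    λ₁ * (λ₂ * (λ₃ * U a b c))
      ≈⟨ *-congˡ (*-congˡ (sym (resN (U a b)))) ⟩
    λ₁ * (λ₂ * sum (λ γ → N γ ⟪ U a b ⟫))
      ≈⟨ *-congˡ (sym (resM (λ b′ → sum (λ γ → N γ ⟪ U a b′ ⟫)))) ⟩
    λ₁ * sum (λ β → M β ⟪ (λ b′ → sum (λ γ → N γ ⟪ U a b′ ⟫)) ⟫)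
      ≈⟨ sym (resL (λ a′ → sum (λ β → M β ⟪ (λ b′ → sum (λ γ → N γ ⟪ U a′ b′ ⟫)) ⟫))) ⟩
    sum (λ α → L α ⟪ (λ a′ → sum (λ β → M β ⟪ (λ b′ → sum (λ γ → N γ ⟪ U a′ b′ ⟫)) ⟫)) ⟫)
      ≈⟨ sum-cong-≋ distribute ⟩
    sum (λ α → sum (λ β → sum (λ γ → apply₃ (L α) (M β) (N γ) U))) ∎
    where
    distribute : ∀ α →
      L α ⟪ (λ a′ → sum (λ β → M β ⟪ (λ b′ → sum (λ γ → N γ ⟪ U a′ b′ ⟫)) ⟫)) ⟫ ≈
      sum (λ β → sum (λ γ → apply₃ (L α) (M β) (N γ) U))
    distribute α = begin
      L α ⟪ (λ a′ → sum (λ β → M β ⟪ (λ b′ → sum (λ γ → N γ ⟪ U a′ b′ ⟫)) ⟫)) ⟫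
        ≈⟨ apply-cong (L α) (λ a′ →
             sum-cong-≋ (λ β → ⟪⟫-sum (M β) (λ γ b′ → N γ ⟪ U a′ b′ ⟫))) ⟩
      L α ⟪ (λ a′ → sum (λ β → sum (λ γ → M β ⟪ (λ b′ → N γ ⟪ U a′ b′ ⟫) ⟫))) ⟫
        ≈⟨ ⟪⟫-sum (L α) (λ β a′ → sum (λ γ → M β ⟪ (λ b′ → N γ ⟪ U a′ b′ ⟫) ⟫)) ⟩
      sum (λ β → L α ⟪ (λ a′ → sum (λ γ → M β ⟪ (λ b′ → N γ ⟪ U a′ b′ ⟫) ⟫)) ⟫)
        ≈⟨ sum-cong-≋ (λ β → ⟪⟫-sum (L α) (λ γ a′ → M β ⟪ (λ b′ → N γ ⟪ U a′ b′ ⟫) ⟫)) ⟩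
      sum (λ β → sum (λ γ → apply₃ (L α) (M β) (N γ) U)) ∎

  apply₃-decomposition-vanishes :
    ∀ {A B C r s t} (L : Functional A) (M : Functional B) (N : Functional C)
      (a : Fin r → A → Carrier) (b : Fin r → B → C → Carrier)
      (cc : Fin s → B → Carrier) (d : Fin s → A → C → Carrier)
      (e : Fin t → C → Carrier) (f : Fin t → A → B → Carrier) →
    (∀ i → L ⟪ a i ⟫ ≈ 0#) → (∀ j → M ⟪ cc j ⟫ ≈ 0#) → (∀ k → N ⟪ e k ⟫ ≈ 0#) →
    apply₃ L M N (λ x y z → (sum (λ i → a i x * b i y z) + sum (λ j → cc j y * d j x z))
                             + sum (λ k → e k z * f k x y)) ≈ 0#
  apply₃-decomposition-vanishes L M N a b cc d e f La≈0 Mc≈0 Ne≈0 = begin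
    apply₃ L M N (λ x y z → (Sa x y z + Sc x y z) + Se x y z)
      ≈⟨ apply₃-+ L M N _ Se ⟩
    apply₃ L M N (λ x y z → Sa x y z + Sc x y z) + apply₃ L M N Se
      ≈⟨ +-congʳ (apply₃-+ L M N Sa Sc) ⟩
    (apply₃ L M N Sa + apply₃ L M N Sc) + apply₃ L M N Se
      ≈⟨ +-cong (+-cong a-part c-part) e-part ⟩
    (0# + 0#) + 0# ≈⟨ trans (+-identityʳ _) (+-identityʳ _) ⟩
    0# ∎
    where
    Sa = λ x y z → sum (λ i → a i x * b i y z)
    Sc = λ x y z → sum (λ j → cc j y * d j x z)
    Se = λ x y z → sum (λ k → e k z * f k x y)
    a-part : apply₃ L M N Sa ≈ 0#
    a-part = trans
      (apply-cong L (λ x → trans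
        (apply-cong M (λ y → ⟪⟫-combination N (λ i → a i x) (λ i → b i y)))
        (⟪⟫-combination M (λ i → a i x) (λ i y → N ⟪ b i y ⟫))))
      (⟪⟫-annihilates-span L a (λ i → M ⟪ (λ y → N ⟪ b i y ⟫) ⟫) La≈0)
    c-part : apply₃ L M N Sc ≈ 0#
    c-part = ⟪⟫-zero L (λ x → trans
      (apply-cong M (λ y → ⟪⟫-combination N (λ j → cc j y) (λ j → d j x)))
      (⟪⟫-annihilates-span M cc (λ j → N ⟪ d j x ⟫) Mc≈0))
    e-part : apply₃ L M N Se ≈ 0#
    e-part = ⟪⟫-zero L (λ x → ⟪⟫-zero M (λ y →
      ⟪⟫-annihilates-span N e (λ k → f k x y) Ne≈0))

  -- Component α annihilates every block except block α − 1, so three components leave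
  -- at least one of the four decompositions untouched.
  block-avoiding : (α β γ : Fin 5) → ∃[ θ ] (α ≢ suc θ × β ≢ suc θ × γ ≢ suc θ)
  block-avoiding = toWitness {a? = all? λ α → all? λ β → all? λ γ → any? λ θ →
                       ¬? (α ≟ suc θ) ×-dec ¬? (β ≟ suc θ) ×-dec ¬? (γ ≟ suc θ)} _

  tensor-vanishes :
    ∀ {A B C : Set} (T : A → B → C → Carrier) (r s t : Fin 4 → ℕ)
      (a : ∀ θ → Fin (r θ) → A → Carrier) (b : ∀ θ → Fin (r θ) → B → C → Carrier)
      (cc : ∀ θ → Fin (s θ) → B → Carrier) (d : ∀ θ → Fin (s θ) → A → C → Carrier)
      (e : ∀ θ → Fin (t θ) → C → Carrier) (f : ∀ θ → Fin (t θ) → A → B → Carrier) →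
    (∀ θ x y z → T x y z ≈ (sum (λ i → a θ i x * b θ i y z)
                            + sum (λ j → cc θ j y * d θ j x z))
                            + sum (λ k → e θ k z * f θ k x y)) →
    Independent (sumΣ r) (flatten a) → Independent (sumΣ s) (flatten cc) →
    Independent (sumΣ t) (flatten e) →
    ∀ x y z → T x y z ≈ 0#
  tensor-vanishes T r s t a b cc d e f T≈ ia ic ie x y z =
    Z.scale-faithful _ λ pz → Y.scale-faithful _ λ py → X.scale-faithful _ λ px → begin
      X.scale px * (Y.scale py * (Z.scale pz * T x y z))
        ≈⟨ resolve₃ {L = PX px} {PY py} {PZ pz} (Resolution.components-resolve X px x)
             (Resolution.components-resolve Y py y) (Resolution.components-resolve Z pz z) T ⟩
      sum (λ α → sum (λ β → sum (λ γ → apply₃ (PX px α) (PY py β) (PZ pz γ) T)))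
        ≈⟨ sum-zero (λ α → sum-zero (λ β → sum-zero (λ γ → term-vanishes px py pz α β γ))) ⟩
      0# ∎
    where
    X : DualFamily (flatten a)
    X = dualFamilyΣ ia
    Y : DualFamily (flatten cc)
    Y = dualFamilyΣ ic
    Z : DualFamily (flatten e)
    Z = dualFamilyΣ ie
    module X = DualFamily X
    module Y = DualFamily Y
    module Z = DualFamily Z
    PX : X.Param → Fin 5 → Functional _
    PX px = Resolution.component X px x
    PY : Y.Param → Fin 5 → Functional _
    PY py = Resolution.component Y py y
    PZ : Z.Param → Fin 5 → Functional _
    PZ pz = Resolution.component Z pz z
    term-vanishes : ∀ px py pz α β γ → apply₃ (PX px α) (PY py β) (PZ pz γ) T ≈ 0#
    term-vanishes px py pz α β γ =
      let θ , α≢θ , β≢θ , γ≢θ = block-avoiding α β γ in trans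
        (apply₃-cong (PX px α) (PY py β) (PZ pz γ) (T≈ θ))
        (apply₃-decomposition-vanishes (PX px α) (PY py β) (PZ pz γ)
          (a θ) (b θ) (cc θ) (d θ) (e θ) (f θ)
          (λ i → Resolution.component-kills X px x α θ i α≢θ)
          (λ j → Resolution.component-kills Y py y β θ j β≢θ)
          (λ k → Resolution.component-kills Z pz z γ θ k γ≢θ))

module _ {c ℓ : Level} (F : Field c ℓ) where
  open Field F using (_+_; reflexive; trans; semiring; commutativeRing)
  open FieldOps F using (∑; ∑Σ; LinearlyIndependent)
  open import Algebra.Properties.Semiring.Sum semiring using (sum; sum-cong-≗)
  open TensorVanishing commutativeRing using (sumΣ; Independent)

  ∑≡sum : ∀ n f → ∑ n f ≡ sum f
  ∑≡sum zero    f = ≡.refl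
  ∑≡sum (suc n) f = ≡.cong (f zero +_) (∑≡sum n (f ∘ suc))

  ∑Σ≡sumΣ : ∀ k (r : Fin k → ℕ) f → ∑Σ k r f ≡ sumΣ r f
  ∑Σ≡sumΣ k r f = ≡.trans (∑≡sum k _) (sum-cong-≗ (λ θ → ∑≡sum (r θ) _))

  linearlyIndependent⇒independent : ∀ {k r N v} →
    LinearlyIndependent k r N v → Independent (sumΣ r) v
  linearlyIndependent⇒independent {k} {r} ind λc λc·v≈0 =
    ind λc (λ x → trans (reflexive (∑Σ≡sumΣ k r _)) (λc·v≈0 x))

proposition6p3 : {c ℓ : Level} (F : Field c ℓ)
    (n₁ n₂ n₃ : ℕ) (T : Fin n₁ → Fin n₂ → Fin n₃ → Field.Carrier F)
    (r s t : Fin 4 → ℕ)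
    (a : (θ : Fin 4) → Fin (r θ) → Fin n₁ → Field.Carrier F)
    (b : (θ : Fin 4) → Fin (r θ) → Fin n₂ → Fin n₃ → Field.Carrier F)
    (cc : (θ : Fin 4) → Fin (s θ) → Fin n₂ → Field.Carrier F)
    (d : (θ : Fin 4) → Fin (s θ) → Fin n₁ → Fin n₃ → Field.Carrier F)
    (e : (θ : Fin 4) → Fin (t θ) → Fin n₃ → Field.Carrier F)
    (f : (θ : Fin 4) → Fin (t θ) → Fin n₁ → Fin n₂ → Field.Carrier F)
    → (∀ θ x y z → Field._≈_ F (T x y z)
          (Field._+_ F
            (Field._+_ F
              (FieldOps.∑ F (r θ) (λ i → Field._*_ F (a θ i x) (b θ i y z)))
              (FieldOps.∑ F (s θ) (λ j → Field._*_ F (cc θ j y) (d θ j x z))))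
            (FieldOps.∑ F (t θ) (λ k → Field._*_ F (e θ k z) (f θ k x y)))))
    → FieldOps.LinearlyIndependent F 4 r n₁ (flatten a)
    → FieldOps.LinearlyIndependent F 4 s n₂ (flatten cc)
    → FieldOps.LinearlyIndependent F 4 t n₃ (flatten e)
    → ∀ x y z → Field._≈_ F (T x y z) (Field.0# F)
proposition6p3 F n₁ n₂ n₃ T r s t a b cc d e f T≈ ia ic ie =
  TensorVanishing.tensor-vanishes (Field.commutativeRing F) T r s t a b cc d e f
    (λ θ x y z → Field.trans F (T≈ θ x y z) (Field.reflexive F
      (≡.cong₂ (Field._+_ F) (≡.cong₂ (Field._+_ F) (∑≡sum F (r θ) _) (∑≡sum F (s θ) _))
               (∑≡sum F (t θ) _))))
    (linearlyIndependent⇒independent F {v = flatten a} ia)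
    (linearlyIndependent⇒independent F {v = flatten cc} ic)
    (linearlyIndependent⇒independent F {v = flatten e} ie)
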